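{- Let $n,m$ be positive integers and let $R_1,\dots,R_n:\{0,\dots,m\}\to\mathbb{R}$ be arbitrary functions with $R_j(0)=0$. Let $0\le k<nm$ and let $\mathbf{x}$ be an optimal $k$-profile. Then there exists an optimal $(k+1)$-profile $\mathbf{y}$ such that $\mathrm{diff}(\mathbf{x},\mathbf{y})$ is irreducible.
   Context: A $k$-profile is a vector $\mathbf{x}=(x_1,\dots,x_n)$ with $x_i\in\{0,\dots,m\}$ and $\sum_i x_i=k$; it is optimal if its revenue $\sum_i R_i(x_i)$ is maximum among all $k$-profiles. For a $k$-profile $\mathbf{x}$ and a $(k+1)$-profile $\mathbf{y}$, $\mathrm{diff}(\mathbf{x},\mathbf{y})=(A,B)$ where $A$ is the multiset $\{y_i-x_i: i\in[n],\ y_i>x_i\}$ and $B$ is the multiset $\{x_i-y_i: i\in[n],\ x_i>y_i\}$ (both multisets of elements of $\{1,\dots,m\}$). A pair $(A,B)$ of such multisets is reducible if there are a nonempty sub-multiset $A'\subseteq A$ and a nonempty sub-multiset $B'\subseteq B$ with equal sums of elements, and irreducible otherwise. -}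

module Defs where

open import Level using (0ℓ)
open import Data.Nat using (ℕ; zero; suc; _+_; _∸_; _<?_)
open import Data.Fin using (Fin; toℕ)
open import Data.List using (List; []; _∷_; mapMaybe; allFin)
import Data.List as List
open import Data.Nat.ListAction using (sum)
open import Data.Maybe using (Maybe; just; nothing)
open import Data.Product using (Σ; _×_; ∃-syntax)
open import Relation.Nullary using (¬_; yes; no)
open import Relation.Binary.PropositionalEquality using (_≡_)
open import Relation.Binary.Structures using (IsTotalOrder)
open import Algebra.Structures using (IsAbelianGroup)
open import Data.List.Relation.Binary.Sublist.Propositional using (_⊆_)

-- The real numbers (ℝ, +, 0, -, ≤) are an instance; ℝ itself is not
-- available in agda-stdlib, so the theorem is stated for every such group.
record OrderedAbelianGroup : Set₁ where
  infixl 6 _+ᴳ_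
  infix 4 _≤ᴳ_
  field
    Carrier : Set
    _+ᴳ_ : Carrier → Carrier → Carrier
    0ᴳ : Carrier
    -ᴳ_ : Carrier → Carrier
    _≤ᴳ_ : Carrier → Carrier → Set
    isAbelianGroup : IsAbelianGroup _≡_ _+ᴳ_ 0ᴳ -ᴳ_
    isTotalOrder : IsTotalOrder _≡_ _≤ᴳ_
    +-monoˡ-≤ : ∀ {a b} c → a ≤ᴳ b → a +ᴳ c ≤ᴳ b +ᴳ c

sumℕ : ∀ {n} → (Fin n → ℕ) → ℕ
sumℕ {n} f = sum (List.map f (allFin n))

IsProfile : ∀ {n m} → ℕ → (Fin n → Fin (suc m)) → Set
IsProfile k x = sumℕ (λ i → toℕ (x i)) ≡ k

module _ (G : OrderedAbelianGroup) where
  open OrderedAbelianGroup G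

  revenue : ∀ {n m} → (Fin n → Fin (suc m) → Carrier) → (Fin n → Fin (suc m)) → Carrier
  revenue {n} R x = List.foldr (λ i acc → R i (x i) +ᴳ acc) 0ᴳ (allFin n)

  IsOptimal : ∀ {n m} → (Fin n → Fin (suc m) → Carrier) → ℕ → (Fin n → Fin (suc m)) → Set
  IsOptimal {n} {m} R k x =
    IsProfile k x × (∀ (x' : Fin n → Fin (suc m)) → IsProfile k x' → revenue R x' ≤ᴳ revenue R x)

posDiffs : ∀ {n m} → (Fin n → Fin (suc m)) → (Fin n → Fin (suc m)) → List ℕ
posDiffs {n} u v = mapMaybe f (allFin n)
  where
  f : Fin _ → Maybe ℕ
  f i with toℕ (u i) <? toℕ (v i)
  ... | yes _ = just (toℕ (v i) ∸ toℕ (u i))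
  ... | no _ = nothing

diffA diffB : ∀ {n m} → (Fin n → Fin (suc m)) → (Fin n → Fin (suc m)) → List ℕ
diffA x y = posDiffs x y
diffB x y = posDiffs y x

-- Sub-multisets of a multiset represented by a list = sublists.
Reducible : List ℕ → List ℕ → Set
Reducible A B =
  ∃[ A' ] ∃[ B' ] (A' ⊆ A × ¬ (A' ≡ []) × B' ⊆ B × ¬ (B' ≡ []) × sum A' ≡ sum B')

Irreducible : List ℕ → List ℕ → Set
Irreducible A B = ¬ Reducible A B

{-# OPTIONS --safe #-}

-- Start from any optimal (k+1)-profile y. If diff(x, y) is reducible, let S be the set of
-- coordinates carrying the two equal-sum sub-multisets A′ ⊆ A and B′ ⊆ B, and exchange x and y
-- on S. As sum A′ = sum B′, this turns x into a k-profile x′ and y into a (k+1)-profile y′,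
-- and R(x′) + R(y′) = R(x) + R(y). Optimality of x gives R(x′) ≤ R(x), hence R(y) ≤ R(y′),
-- so y′ is again optimal; and y′ is closer to x, since Σᵢ (yᵢ ∸ xᵢ) drops by sum A′ > 0.
-- Iterating terminates in an optimal y with diff(x, y) irreducible.
module Submission where

open import Level using (0ℓ)
open import Algebra.Bundles using (AbelianGroup; CommutativeSemigroup)
open import Algebra.Core using (Op₂)
open import Algebra.Structures using (IsCommutativeMonoid; IsAbelianGroup)
import Algebra.Properties.AbelianGroup as AbelianGroupProperties
import Algebra.Properties.CommutativeSemigroup as CommutativeSemigroupProperties
open import Data.Bool using (Bool; true; false; if_then_else_)
open import Data.Fin using (Fin; zero; suc; toℕ; fromℕ<)
open import Data.Fin.Properties using (toℕ-fromℕ<)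
open import Data.List using (List; []; _∷_; map; foldr; allFin; mapMaybe; catMaybes; filter; cartesianProductWith; [_])
open import Data.List.Properties using (map-cong; map-tabulate; foldr-map; foldr-cong; mapMaybe-cong; ≡-dec)
open import Data.List.Membership.Propositional using (_∈_)
open import Data.List.Membership.Propositional.Properties using (∈-allFin; ∈-filter⁺; ∈-cartesianProductWith⁺)
open import Data.List.Relation.Unary.All as All using (All; _∷_)
open import Data.List.Relation.Unary.All.Properties using (mapMaybe⁺; map⁺; tabulate⁺; all-filter)
open import Data.List.Relation.Unary.Any using (here)
open import Data.List.Relation.Binary.Sublist.Propositional using (_⊆_; []; _∷_; _∷ʳ_)
open import Data.List.Relation.Binary.Sublist.Propositional.Properties using (All-resp-⊆)
open import Data.Maybe using (Maybe; just; nothing; maybe′; fromMaybe)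
import Data.Maybe.Relation.Unary.All as Maybe
open import Data.Nat using (ℕ; zero; suc; _+_; _∸_; _*_; _⊓_; _<_; _≤_; _<?_; _≟_; s≤s)
open import Data.Nat.Induction using (<-wellFounded)
open import Data.Nat.ListAction using (sum)
open import Data.Nat.Properties
  using (+-0-isCommutativeMonoid; +-identityʳ; +-cancelʳ-≡; n∸n≡0; m≤n⇒m∸n≡0; ≮⇒≥; m<n⇒0<n∸m;
         <-≤-trans; <⇒≯; m≤m+n; m<m+n; n≤0⇒n≡0; ∸-monoˡ-≤; m+n∸m≡n; m⊓n≤m; m⊓n+n∸m≡n)
open import Data.Product using (Σ; ∃-syntax; _×_; _,_; proj₁; proj₂)
open import Data.Sum using (_⊎_; inj₁; inj₂)
open import Data.Vec.Functional using () renaming ([] to []ᶠ; _∷_ to _∷ᶠ_)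
open import Function using (_∘_; id)
open import Induction.WellFounded using (Acc; acc)
open import Relation.Binary.Bundles using (TotalOrder)
open import Relation.Binary.Structures using (IsTotalOrder)
open import Relation.Binary.PropositionalEquality using (_≡_; refl; sym; trans; cong; cong₂; subst; subst₂; module ≡-Reasoning)
open import Relation.Nullary using (¬_; Dec; yes; no; contradiction)
open import Relation.Nullary.Decidable using (map′; ¬?; _×-dec_; _⊎-dec_)
open import Relation.Unary using (Pred; Decidable)

open import Defs

map-allFin-suc : ∀ {n} {A : Set} (f : Fin (suc n) → A) →
                 map f (allFin (suc n)) ≡ f zero ∷ map (f ∘ suc) (allFin n)
map-allFin-suc f = cong (f zero ∷_) (trans (map-tabulate suc f) (sym (map-tabulate id (f ∘ suc))))

module IndexedSum {A : Set} {_∙_ : Op₂ A} {ε : A}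
                  (isCommutativeMonoid : IsCommutativeMonoid _≡_ _∙_ ε) where

  open IsCommutativeMonoid isCommutativeMonoid using (identityˡ; isCommutativeSemigroup)

  commutativeSemigroup : CommutativeSemigroup 0ℓ 0ℓ
  commutativeSemigroup = record { isCommutativeSemigroup = isCommutativeSemigroup }

  open CommutativeSemigroupProperties commutativeSemigroup using (interchange)

  ∑ : {I : Set} → (I → A) → List I → A
  ∑ f is = foldr _∙_ ε (map f is)

  ∑-cong : ∀ {I : Set} {f g : I → A} → (∀ i → f i ≡ g i) → ∀ is → ∑ f is ≡ ∑ g is
  ∑-cong f≗g is = cong (foldr _∙_ ε) (map-cong f≗g is)

  ∑-distrib : ∀ {I : Set} (f g : I → A) is → ∑ (λ i → f i ∙ g i) is ≡ ∑ f is ∙ ∑ g is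
  ∑-distrib f g []       = sym (identityˡ ε)
  ∑-distrib f g (i ∷ is) = trans (cong (_ ∙_) (∑-distrib f g is)) (interchange _ _ _ _)

  ∑-exchange : ∀ {I : Set} {f g f′ g′ : I → A} → (∀ i → f′ i ∙ g′ i ≡ f i ∙ g i) →
               ∀ is → ∑ f′ is ∙ ∑ g′ is ≡ ∑ f is ∙ ∑ g is
  ∑-exchange {f = f} {g} {f′} {g′} pointwise is = begin
    ∑ f′ is ∙ ∑ g′ is            ≡⟨ ∑-distrib f′ g′ is ⟨
    ∑ (λ i → f′ i ∙ g′ i) is     ≡⟨ ∑-cong pointwise is ⟩
    ∑ (λ i → f i ∙ g i) is       ≡⟨ ∑-distrib f g is ⟩
    ∑ f is ∙ ∑ g is              ∎
    where open ≡-Reasoning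

  ∑-allFin-suc : ∀ {n} (f : Fin (suc n) → A) → ∑ f (allFin (suc n)) ≡ f zero ∙ ∑ (f ∘ suc) (allFin n)
  ∑-allFin-suc f = cong (foldr _∙_ ε) (map-allFin-suc f)

module ℕ∑ = IndexedSum +-0-isCommutativeMonoid

∃-⊆? : ∀ {A : Set} {P : Pred (List A) 0ℓ} → Decidable P → ∀ xs → Dec (∃[ ys ] ys ⊆ xs × P ys)
∃-⊆? P? [] = map′ (λ p → [] , [] , p) (λ { (.[] , [] , p) → p }) (P? [])
∃-⊆? {P = P} P? (x ∷ xs) = map′ extend restrict (∃-⊆? P? xs ⊎-dec ∃-⊆? (P? ∘ (x ∷_)) xs)
  where
  extend : (∃[ ys ] ys ⊆ xs × P ys) ⊎ (∃[ ys ] ys ⊆ xs × P (x ∷ ys)) → ∃[ ys ] ys ⊆ x ∷ xs × P ys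
  extend (inj₁ (ys , τ , p)) = ys , x ∷ʳ τ , p
  extend (inj₂ (ys , τ , p)) = x ∷ ys , refl ∷ τ , p
  restrict : ∃[ ys ] ys ⊆ x ∷ xs × P ys → (∃[ ys ] ys ⊆ xs × P ys) ⊎ (∃[ ys ] ys ⊆ xs × P (x ∷ ys))
  restrict (ys , .x ∷ʳ τ , p)          = inj₁ (ys , τ , p)
  restrict (.x ∷ ys , refl ∷ τ , p)    = inj₂ (ys , τ , p)

nonEmpty? : (xs : List ℕ) → Dec (¬ xs ≡ [])
nonEmpty? xs = ¬? (≡-dec _≟_ xs [])

reducible? : ∀ as bs → Dec (Reducible as bs)
reducible? as bs = map′ reorder unreorder (∃-⊆? matched? as)
  where
  Matched : List ℕ → Set
  Matched as′ = ¬ as′ ≡ [] × ∃[ bs′ ] bs′ ⊆ bs × ¬ bs′ ≡ [] × sum as′ ≡ sum bs′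
  matched? : Decidable Matched
  matched? as′ = nonEmpty? as′ ×-dec ∃-⊆? (λ bs′ → nonEmpty? bs′ ×-dec sum as′ ≟ sum bs′) bs
  reorder : ∃[ as′ ] as′ ⊆ as × Matched as′ → Reducible as bs
  reorder (as′ , τ , as′≢[] , bs′ , σ , bs′≢[] , eq) = as′ , bs′ , τ , as′≢[] , σ , bs′≢[] , eq
  unreorder : Reducible as bs → ∃[ as′ ] as′ ⊆ as × Matched as′
  unreorder (as′ , bs′ , τ , as′≢[] , σ , bs′≢[] , eq) = as′ , τ , as′≢[] , bs′ , σ , bs′≢[] , eq

sum-positive : ∀ {xs} → All (0 <_) xs → ¬ xs ≡ [] → 0 < sum xs
sum-positive {[]}     _        xs≢[] = contradiction refl xs≢[]
sum-positive {x ∷ xs} (0<x ∷ _) _    = <-≤-trans 0<x (m≤m+n x (sum xs))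

_⇂_ : ∀ {n} → (Fin n → Bool) → (Fin n → ℕ) → Fin n → ℕ
(S ⇂ f) i = if S i then f i else 0

⇂-cong : ∀ {n} (S : Fin n → Bool) {f g : Fin n → ℕ} → (∀ i → f i ≡ g i) → ∀ i → (S ⇂ f) i ≡ (S ⇂ g) i
⇂-cong S f≗g i = cong (λ a → if S i then a else 0) (f≗g i)

mapMaybe-allFin-suc : ∀ {n} (F : Fin (suc n) → Maybe ℕ) →
                      mapMaybe F (allFin (suc n)) ≡ maybe′ _∷_ id (F zero) (mapMaybe (F ∘ suc) (allFin n))
mapMaybe-allFin-suc F = cong catMaybes (map-allFin-suc F)

Selects : ∀ {n} → (Fin n → Maybe ℕ) → (Fin n → Maybe ℕ) → ℕ → ℕ → Set
Selects {n} F G a b = ∃[ S ] sumℕ (S ⇂ (fromMaybe 0 ∘ F)) ≡ a × sumℕ (S ⇂ (fromMaybe 0 ∘ G)) ≡ b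

-- Disjointness of the supports lets a single index set realise both sub-multisets.
selects-⊆ : ∀ {n} (F G : Fin n → Maybe ℕ) → (∀ i → F i ≡ nothing ⊎ G i ≡ nothing) →
            ∀ {as bs} → as ⊆ mapMaybe F (allFin n) → bs ⊆ mapMaybe G (allFin n) → Selects F G (sum as) (sum bs)
selects-⊆ {zero}  F G _        [] [] = []ᶠ , refl , refl
selects-⊆ {suc n} F G disjoint τ σ =
  byHead (F zero) (G zero) refl refl (disjoint zero)
         (subst (_ ⊆_) (mapMaybe-allFin-suc F) τ) (subst (_ ⊆_) (mapMaybe-allFin-suc G) σ)
  where
  byTail : ∀ {as bs} → as ⊆ mapMaybe (F ∘ suc) (allFin n) → bs ⊆ mapMaybe (G ∘ suc) (allFin n) →
           Selects (F ∘ suc) (G ∘ suc) (sum as) (sum bs)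
  byTail = selects-⊆ (F ∘ suc) (G ∘ suc) (disjoint ∘ suc)
  cons : ∀ {a b a′ b′} (s : Bool) →
         (if s then fromMaybe 0 (F zero) else 0) + a ≡ a′ →
         (if s then fromMaybe 0 (G zero) else 0) + b ≡ b′ →
         Selects (F ∘ suc) (G ∘ suc) a b → Selects F G a′ b′
  cons s headA headB (S , sumA , sumB) =
    s ∷ᶠ S ,
    trans (ℕ∑.∑-allFin-suc ((s ∷ᶠ S) ⇂ (fromMaybe 0 ∘ F))) (trans (cong (_ +_) sumA) headA) ,
    trans (ℕ∑.∑-allFin-suc ((s ∷ᶠ S) ⇂ (fromMaybe 0 ∘ G))) (trans (cong (_ +_) sumB) headB)
  byHead : ∀ a b {as bs} → F zero ≡ a → G zero ≡ b → a ≡ nothing ⊎ b ≡ nothing →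
           as ⊆ maybe′ _∷_ id a (mapMaybe (F ∘ suc) (allFin n)) →
           bs ⊆ maybe′ _∷_ id b (mapMaybe (G ∘ suc) (allFin n)) → Selects F G (sum as) (sum bs)
  byHead nothing  nothing  _  _  _ τ          σ          = cons false refl refl (byTail τ σ)
  byHead (just a) nothing  _  _  _ (_ ∷ʳ τ)   σ          = cons false refl refl (byTail τ σ)
  byHead (just a) nothing  Fa Gb _ (refl ∷ τ) σ          =
    cons true (cong (λ c → fromMaybe 0 c + _) Fa) (cong (λ c → fromMaybe 0 c + _) Gb) (byTail τ σ)
  byHead nothing  (just b) _  _  _ τ          (_ ∷ʳ σ)   = cons false refl refl (byTail τ σ)
  byHead nothing  (just b) Fa Gb _ τ          (refl ∷ σ) =
    cons true (cong (λ c → fromMaybe 0 c + _) Fa) (cong (λ c → fromMaybe 0 c + _) Gb) (byTail τ σ)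
  byHead (just _) (just _) _  _  (inj₁ ()) _ _
  byHead (just _) (just _) _  _  (inj₂ ()) _ _

increase : ℕ → ℕ → Maybe ℕ
increase a b with a <? b
... | yes _ = just (b ∸ a)
... | no  _ = nothing

fromMaybe-increase : ∀ a b → fromMaybe 0 (increase a b) ≡ b ∸ a
fromMaybe-increase a b with a <? b
... | yes _   = refl
... | no  a≮b = sym (m≤n⇒m∸n≡0 (≮⇒≥ a≮b))

increase-positive : ∀ a b → Maybe.All (0 <_) (increase a b)
increase-positive a b with a <? b
... | yes a<b = Maybe.just (m<n⇒0<n∸m a<b)
... | no  _   = Maybe.nothing

increase-disjoint : ∀ a b → increase a b ≡ nothing ⊎ increase b a ≡ nothing
increase-disjoint a b with a <? b | b <? a
... | no  _   | _       = inj₁ refl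
... | yes _   | no  _   = inj₂ refl
... | yes a<b | yes b<a = contradiction b<a (<⇒≯ a<b)

increaseAt : ∀ {n m} → (Fin n → Fin (suc m)) → (Fin n → Fin (suc m)) → Fin n → Maybe ℕ
increaseAt u v i = increase (toℕ (u i)) (toℕ (v i))

-- posDiffs filters through a function local to its where-block; unifying posDiffs u v with
-- mapMaybe F (allFin n) gives that function a name.
selectorOf : ∀ {n} (xs : List ℕ) {F : Fin n → Maybe ℕ} → xs ≡ mapMaybe F (allFin n) → Fin n → Maybe ℕ
selectorOf _ {F} _ = F

selectorOf-posDiffs : ∀ {n m} (u v : Fin n → Fin (suc m)) i → selectorOf (posDiffs u v) refl i ≡ increaseAt u v i
selectorOf-posDiffs u v i with toℕ (u i) <? toℕ (v i)
... | yes _ = refl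
... | no  _ = refl

posDiffs≡ : ∀ {n m} (u v : Fin n → Fin (suc m)) → posDiffs u v ≡ mapMaybe (increaseAt u v) (allFin n)
posDiffs≡ {n} u v = mapMaybe-cong (selectorOf-posDiffs u v) (allFin n)

posDiffs-positive : ∀ {n m} (u v : Fin n → Fin (suc m)) → All (0 <_) (posDiffs u v)
posDiffs-positive u v =
  subst (All (0 <_)) (sym (posDiffs≡ u v))
        (mapMaybe⁺ (map⁺ (tabulate⁺ (λ i → increase-positive (toℕ (u i)) (toℕ (v i))))))

size : ∀ {n m} → (Fin n → Fin (suc m)) → ℕ
size u = sumℕ (toℕ ∘ u)

size-cong : ∀ {n m} {u v : Fin n → Fin (suc m)} → (∀ i → u i ≡ v i) → size u ≡ size v
size-cong {n} u≗v = ℕ∑.∑-cong (cong toℕ ∘ u≗v) (allFin n)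

rise : ∀ {n m} → (Fin n → Fin (suc m)) → (Fin n → Fin (suc m)) → Fin n → ℕ
rise u v i = toℕ (v i) ∸ toℕ (u i)

increaseOn : ∀ {n m} → (Fin n → Bool) → (Fin n → Fin (suc m)) → (Fin n → Fin (suc m)) → ℕ
increaseOn S u v = sumℕ (S ⇂ rise u v)

splice : ∀ {n} {A : Set} → (Fin n → Bool) → (Fin n → A) → (Fin n → A) → Fin n → A
splice S u v i = if S i then v i else u i

m+[n∸m]≡n+[m∸n] : ∀ m n → m + (n ∸ m) ≡ n + (m ∸ n)
m+[n∸m]≡n+[m∸n] zero    zero    = refl
m+[n∸m]≡n+[m∸n] zero    (suc n) = cong suc (sym (+-identityʳ n))
m+[n∸m]≡n+[m∸n] (suc m) zero    = cong suc (+-identityʳ m)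
m+[n∸m]≡n+[m∸n] (suc m) (suc n) = cong suc (m+[n∸m]≡n+[m∸n] m n)

size-splice : ∀ {n m} (S : Fin n → Bool) (u v : Fin n → Fin (suc m)) →
              size (splice S u v) + increaseOn S v u ≡ size u + increaseOn S u v
size-splice {n} S u v = ℕ∑.∑-exchange pointwise (allFin n)
  where
  pointwise : ∀ i → toℕ (splice S u v i) + (S ⇂ rise v u) i ≡ toℕ (u i) + (S ⇂ rise u v) i
  pointwise i with S i
  ... | true  = m+[n∸m]≡n+[m∸n] (toℕ (v i)) (toℕ (u i))
  ... | false = refl

size-splice-balanced : ∀ {n m} (S : Fin n → Bool) (u v : Fin n → Fin (suc m)) →
                       increaseOn S u v ≡ increaseOn S v u → size (splice S u v) ≡ size u
size-splice-balanced S u v balanced =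
  +-cancelʳ-≡ _ _ _ (trans (size-splice S u v) (cong (size u +_) balanced))

rise-splice : ∀ {n m} (S : Fin n → Bool) (u v : Fin n → Fin (suc m)) →
              sumℕ (rise u v) ≡ sumℕ (rise u (splice S v u)) + increaseOn S u v
rise-splice {n} S u v =
  trans (ℕ∑.∑-cong pointwise (allFin n)) (ℕ∑.∑-distrib (rise u (splice S v u)) (S ⇂ rise u v) (allFin n))
  where
  pointwise : ∀ i → rise u v i ≡ rise u (splice S v u) i + (S ⇂ rise u v) i
  pointwise i with S i
  ... | true  = cong (_+ rise u v i) (sym (n∸n≡0 (toℕ (u i))))
  ... | false = sym (+-identityʳ (rise u v i))

increaseOn-fromMaybe : ∀ {n m} (S : Fin n → Bool) (u v : Fin n → Fin (suc m)) →
                       sumℕ (S ⇂ (fromMaybe 0 ∘ increaseAt u v)) ≡ increaseOn S u v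
increaseOn-fromMaybe {n} S u v =
  ℕ∑.∑-cong (⇂-cong S (λ i → fromMaybe-increase (toℕ (u i)) (toℕ (v i)))) (allFin n)

reducible⇒balanced-splice : ∀ {n m} {u v : Fin n → Fin (suc m)} → Reducible (diffA u v) (diffB u v) →
                            ∃[ S ] increaseOn S u v ≡ increaseOn S v u × 0 < increaseOn S u v
reducible⇒balanced-splice {u = u} {v} (as , bs , as⊆ , as≢[] , bs⊆ , bs≢[] , sum-as≡sum-bs)
  with selects-⊆ (increaseAt u v) (increaseAt v u) (λ i → increase-disjoint (toℕ (u i)) (toℕ (v i)))
                 (subst (as ⊆_) (posDiffs≡ u v) as⊆) (subst (bs ⊆_) (posDiffs≡ v u) bs⊆)
... | S , sumA , sumB = S , trans increaseA (trans sum-as≡sum-bs (sym increaseB)) , positive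
  where
  increaseA : increaseOn S u v ≡ sum as
  increaseA = trans (sym (increaseOn-fromMaybe S u v)) sumA
  increaseB : increaseOn S v u ≡ sum bs
  increaseB = trans (sym (increaseOn-fromMaybe S v u)) sumB
  positive : 0 < increaseOn S u v
  positive = subst (0 <_) (sym increaseA) (sum-positive (All-resp-⊆ as⊆ (posDiffs-positive u v)) as≢[])

functions : ∀ n {A : Set} → List A → List (Fin n → A)
functions zero    as = [ []ᶠ ]
functions (suc n) as = cartesianProductWith _∷ᶠ_ as (functions n as)

functions-complete : ∀ {n} {A : Set} {as : List A} → (∀ a → a ∈ as) →
                     ∀ (f : Fin n → A) → ∃[ g ] g ∈ functions n as × (∀ i → f i ≡ g i)
functions-complete {zero}  _        f = []ᶠ , here refl , λ ()
functions-complete {suc n} complete f with functions-complete complete (f ∘ suc)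
... | g , g∈ , f∘suc≗g = f zero ∷ᶠ g , ∈-cartesianProductWith⁺ _∷ᶠ_ (complete (f zero)) g∈ , f≗g
  where
  f≗g : ∀ i → f i ≡ (f zero ∷ᶠ g) i
  f≗g zero    = refl
  f≗g (suc i) = f∘suc≗g i

profile-exists : ∀ n m k → k ≤ n * m → Σ (Fin n → Fin (suc m)) (IsProfile k)
profile-exists zero    m k k≤0 = []ᶠ , sym (n≤0⇒n≡0 k≤0)
profile-exists (suc n) m k k≤m+n*m with profile-exists n m (k ∸ m) k∸m≤n*m
  where
  k∸m≤n*m : k ∸ m ≤ n * m
  k∸m≤n*m = subst (k ∸ m ≤_) (m+n∸m≡n m (n * m)) (∸-monoˡ-≤ m k≤m+n*m)
... | x , x-size = first ∷ᶠ x , trans (ℕ∑.∑-allFin-suc (toℕ ∘ (first ∷ᶠ x)))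
                                     (trans (cong₂ _+_ (toℕ-fromℕ< m⊓k<1+m) x-size) (m⊓n+n∸m≡n m k))
  where
  m⊓k<1+m : m ⊓ k < suc m
  m⊓k<1+m = s≤s (m⊓n≤m m k)
  first : Fin (suc m)
  first = fromℕ< m⊓k<1+m

module _ (G : OrderedAbelianGroup) where

  open OrderedAbelianGroup G
  open IsAbelianGroup isAbelianGroup using (assoc; comm; isCommutativeMonoid)
  open IsTotalOrder isTotalOrder using () renaming (trans to ≤ᴳ-trans)
  open IndexedSum isCommutativeMonoid using (∑; ∑-exchange)

  abelianGroup : AbelianGroup 0ℓ 0ℓ
  abelianGroup = record { isAbelianGroup = isAbelianGroup }

  open AbelianGroupProperties abelianGroup using (xyx⁻¹≈y)

  x≤y∧x+z≡y+w⇒w≤z : ∀ {x y z w} → x ≤ᴳ y → x +ᴳ z ≡ y +ᴳ w → w ≤ᴳ z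
  x≤y∧x+z≡y+w⇒w≤z {x} {y} {z} {w} x≤y x+z≡y+w =
    subst₂ _≤ᴳ_ x+[w-x]≡w y+[w-x]≡z (+-monoˡ-≤ (w +ᴳ -ᴳ x) x≤y)
    where
    open ≡-Reasoning
    x+[w-x]≡w : x +ᴳ (w +ᴳ -ᴳ x) ≡ w
    x+[w-x]≡w = trans (sym (assoc x w (-ᴳ x))) (xyx⁻¹≈y x w)
    y+[w-x]≡z : y +ᴳ (w +ᴳ -ᴳ x) ≡ z
    y+[w-x]≡z = begin
      y +ᴳ (w +ᴳ -ᴳ x)   ≡⟨ assoc y w (-ᴳ x) ⟨
      (y +ᴳ w) +ᴳ -ᴳ x   ≡⟨ cong (_+ᴳ -ᴳ x) x+z≡y+w ⟨
      (x +ᴳ z) +ᴳ -ᴳ x   ≡⟨ xyx⁻¹≈y x z ⟩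
      z                  ∎

  revenue-∑ : ∀ {n m} (R : Fin n → Fin (suc m) → Carrier) x → revenue G R x ≡ ∑ (λ i → R i (x i)) (allFin n)
  revenue-∑ {n} R x = sym (foldr-map _+ᴳ_ (λ i → R i (x i)) 0ᴳ (allFin n))

  revenue-cong : ∀ {n m} (R : Fin n → Fin (suc m) → Carrier) {x y} → (∀ i → x i ≡ y i) →
                 revenue G R x ≡ revenue G R y
  revenue-cong {n} R x≗y = foldr-cong (λ i acc → cong (λ a → R i a +ᴳ acc) (x≗y i)) refl (allFin n)

  revenue-splice : ∀ {n m} (R : Fin n → Fin (suc m) → Carrier) (S : Fin n → Bool) (u v : Fin n → Fin (suc m)) →
                   revenue G R (splice S u v) +ᴳ revenue G R (splice S v u) ≡ revenue G R u +ᴳ revenue G R v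
  revenue-splice {n} R S u v = begin
    revenue G R (splice S u v) +ᴳ revenue G R (splice S v u)
      ≡⟨ cong₂ _+ᴳ_ (revenue-∑ R (splice S u v)) (revenue-∑ R (splice S v u)) ⟩
    _ ≡⟨ ∑-exchange pointwise (allFin n) ⟩
    _ ≡⟨ cong₂ _+ᴳ_ (revenue-∑ R u) (revenue-∑ R v) ⟨
    revenue G R u +ᴳ revenue G R v ∎
    where
    open ≡-Reasoning
    pointwise : ∀ i → R i (splice S u v i) +ᴳ R i (splice S v u i) ≡ R i (u i) +ᴳ R i (v i)
    pointwise i with S i
    ... | true  = comm (R i (v i)) (R i (u i))
    ... | false = refl

  splice-optimal : ∀ {n m} {R : Fin n → Fin (suc m) → Carrier} {k x y} →
                   IsOptimal G R k x → IsOptimal G R (suc k) y →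
                   ∀ S → increaseOn S x y ≡ increaseOn S y x → IsOptimal G R (suc k) (splice S y x)
  splice-optimal {R = R} {k} {x} {y} (x-size , x-max) (y-size , y-max) S balanced =
    trans (size-splice-balanced S y x (sym balanced)) y-size ,
    λ z z-size → ≤ᴳ-trans (y-max z z-size) (x≤y∧x+z≡y+w⇒w≤z (x-max (splice S x y) x′-size) (revenue-splice R S x y))
    where
    x′-size : IsProfile k (splice S x y)
    x′-size = trans (size-splice-balanced S x y balanced) x-size

  totalOrder : TotalOrder 0ℓ 0ℓ 0ℓ
  totalOrder = record { isTotalOrder = isTotalOrder }

  open import Data.List.Extrema totalOrder using (argmax; argmax-all; f[xs]≤f[argmax])

  optimal-exists : ∀ {n m} (R : Fin n → Fin (suc m) → Carrier) k → k ≤ n * m →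
                   Σ (Fin n → Fin (suc m)) (IsOptimal G R k)
  optimal-exists {n} {m} R k k≤n*m = best , argmax-all (revenue G R) x₀-size (all-filter size≟k candidates) , maximal
    where
    size≟k : (u : Fin n → Fin (suc m)) → Dec (IsProfile k u)
    size≟k u = size u ≟ k
    candidates : List (Fin n → Fin (suc m))
    candidates = functions n (allFin (suc m))
    x₀ : Fin n → Fin (suc m)
    x₀ = proj₁ (profile-exists n m k k≤n*m)
    x₀-size : IsProfile k x₀
    x₀-size = proj₂ (profile-exists n m k k≤n*m)
    best : Fin n → Fin (suc m)
    best = argmax (revenue G R) x₀ (filter size≟k candidates)
    maximal : ∀ z → IsProfile k z → revenue G R z ≤ᴳ revenue G R best
    maximal z z-size with functions-complete ∈-allFin z
    ... | g , g∈ , z≗g =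
      subst (_≤ᴳ revenue G R best) (sym (revenue-cong R z≗g))
            (All.lookup (f[xs]≤f[argmax] x₀ (filter size≟k candidates))
                        (∈-filter⁺ size≟k g∈ (trans (sym (size-cong z≗g)) z-size)))

  module _ {n m} (R : Fin n → Fin (suc m) → Carrier) {k x} (x-optimal : IsOptimal G R k x) where

    irreducible-optimal-from : ∀ y → Acc _<_ (sumℕ (rise x y)) → IsOptimal G R (suc k) y →
                               ∃[ y′ ] (IsOptimal G R (suc k) y′ × Irreducible (diffA x y′) (diffB x y′))
    irreducible-optimal-from y (acc smaller) y-optimal with reducible? (diffA x y) (diffB x y)
    ... | no irreducible = y , y-optimal , irreducible
    ... | yes reducible with reducible⇒balanced-splice reducible
    ...   | S , balanced , positive =
      irreducible-optimal-from (splice S y x) (smaller closer) (splice-optimal {R = R} x-optimal y-optimal S balanced)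
      where
      closer : sumℕ (rise x (splice S y x)) < sumℕ (rise x y)
      closer = subst (sumℕ (rise x (splice S y x)) <_) (sym (rise-splice S x y)) (m<m+n _ positive)

lemma3 : (G : OrderedAbelianGroup) (n m : ℕ) → 0 < n → 0 < m →
         (R : Fin n → Fin (suc m) → OrderedAbelianGroup.Carrier G) →
         (∀ j → R j zero ≡ OrderedAbelianGroup.0ᴳ G) →
         (k : ℕ) → k < n * m →
         (x : Fin n → Fin (suc m)) → IsOptimal G R k x →
         ∃[ y ] (IsOptimal G R (suc k) y × Irreducible (diffA x y) (diffB x y))
lemma3 G n m _ _ R _ k k<n*m x x-optimal =
  let y , y-optimal = optimal-exists G R (suc k) k<n*m
  in  irreducible-optimal-from G R x-optimal y (<-wellFounded _) y-optimal
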